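{- Let $G$ be a protected directed graph, let $k=c(G)$ be its cop number (in the directed protected game described in the context), and let $H$ be the protected undirected graph constructed from $G$ as in the context. Consider any placement of $k$ cops on vertices of $H$. Then the cops defend every vertex of $S$ if and only if they occupy a stable position. Moreover, if the cops occupy a stable position, then for each $i\in\{0,1,2\}$ they defend every vertex of $T_i$ if and only if either all cops lie in $C_i$ or the cops occupy all $k$ cop starter vertices.
   Context: Protected game: the board is a graph (directed or undirected) in which every edge, including loops, is labeled protected or unprotected. The cops first choose starting vertices, then the robber does; then the game proceeds in rounds, each consisting of a cop turn (every cop traverses an edge incident to/out of her current vertex; staying put is possible only by traversing a loop) followed by a robber turn (the robber does likewise). The cops win if some cop arrives at the robber's vertex by traversing an unprotected edge (possibly an unprotected loop); in particular the robber may move onto a cop's vertex without being captured. The cop number $c(G)$ is the least number of cops that can guarantee a win. A cop defends a vertex $v$ if there is an unprotected edge joining the cop's current vertex and $v$. Construction of $H$ from a protected directed graph $G$ with $k=c(G)$ (indices $i$ on $C_i,R_i,T_i$ taken mod 3, indices on $s$ taken mod $4k$, lower indices on $t$ mod $k$): the vertex set of $H$ is the disjoint union of $S=\{s_0,\dots,s_{4k-1}\}$ (the core), $T_i=\{t^i_0,\dots,t^i_{k-1}\}$ for $i\in\{0,1,2\}$ (the wings; $S\cup T_0\cup T_1\cup T_2$ is the reset clique), $C_i=\{\kappa(v;i,j): v\in V(G), 0\le j\le k-1\}$ (cop vertices), $R_i=\{\rho(v;i): v\in V(G)\}$ (robber vertices), $C^*=\{c^*_0,\dots,c^*_{k-1}\}$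 (cop starter vertices), and $R^*=\{r^*_0,r^*_1,r^*_2\}$ (robber starter vertices). Edges of $H$ (undirected): every vertex has a loop, protected for vertices of the reset clique and unprotected otherwise; protected edges between every two distinct vertices of the reset clique; unprotected edges $\kappa(v;i,j)\kappa(v;i,j')$ for $j\ne j'$; for each directed edge $\overrightarrow{uv}$ of $G$ ($u=v$ allowed) and all $i,j$, unprotected edges $\kappa(u;i,j)\kappa(v;i+1,j)$ and $\rho(u;i)\rho(v;i+1)$, and additionally the unprotected edge $\kappa(u;i,j)\rho(v;i+1)$ if $\overrightarrow{uv}$ is unprotected; protected edges from each vertex of $R_i$ to each vertex of $S\cup T_i$; unprotected edges from $\kappa(v;i,j)$ to $s_{4j+i},s_{4j+i+1},s_{4j+i+2},s_{4j+i+3}$ and $t^i_j$; unprotected edges from every vertex of $C_i$ to every vertex of $R_i\cup R_{i-1}$; unprotected edges from $c^*_j$ to $s_{4j+3},s_{4j+4},s_{4j+5},s_{4j+6},t^0_j,t^1_j,t^2_j$; unprotected edges from every vertex of $C^*$ to every vertex of $C_0\cup C_1\cup C_2\cup R_0\cup R_1\cup R_2$; unprotected edges from every vertex of $R^*$ to every vertex of $C_0\cup C_1\cup C_2$; unprotected edges from $r^*_i$ to every vertex of $R_{i+1}$; protected edges between each pair of vertices of $R^*$; protected edges from $r^*_i$ to every vertex of $S\cup T_i$. No other edges. The vertices $\kappa(v;i,j)$ (for any $v,i$) and $c^*_j$ are called $j$-vertices. The $k$ cops occupy a stable position if either they occupy all $k$ cop starter vertices, or for some $i$ all cops lie in $C_i$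 and for each $j\in\{0,\dots,k-1\}$ exactly one cop occupies a $j$-vertex. -}

module Defs where

open import Data.Nat using (ℕ; zero; suc; _+_; _*_; _≤_; _<_)
open import Data.Fin using (Fin; toℕ) renaming (zero to f0; suc to fs)
open import Data.Maybe using (Maybe; just; nothing)
open import Data.Product using (Σ; ∃; ∃-syntax; _×_; _,_)
open import Data.Sum using (_⊎_)
open import Relation.Binary.PropositionalEquality using (_≡_)
open import Relation.Nullary using (¬_)
open import Function.Bundles using (_⇔_)

data Label : Set where
  prot unprot : Label

-- A (finite) protected directed graph on vertex set Fin n:
-- G u v = nothing   : no arc u → v
-- G u v = just ℓ    : an arc u → v (u = v is a loop) labelled ℓ.
PDigraph : ℕ → Set
PDigraph n = Fin n → Fin n → Maybe Label

module Game {n : ℕ} (G : PDigraph n) where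

  Arc : Fin n → Fin n → Set
  Arc u v = ∃[ ℓ ] (G u v ≡ just ℓ)

  CopPos : ℕ → Set
  CopPos k = Fin k → Fin n

  CopStep : ∀ {k} → CopPos k → CopPos k → Set
  CopStep c c' = ∀ p → Arc (c p) (c' p)

  Captures : ∀ {k} → CopPos k → CopPos k → Fin n → Set
  Captures c c' r = ∃[ p ] (G (c p) r ≡ just unprot × c' p ≡ r)

  -- CopWin c r : it is the cops' turn, cops at c, robber at r, and the
  -- cops can force a capture in finitely many rounds.
  data CopWin {k : ℕ} : CopPos k → Fin n → Set where
    move : ∀ {c r} (c' : CopPos k) → CopStep c c' →
           (Captures c c' r ⊎ (∀ r' → Arc r r' → CopWin c' r')) →
           CopWin c r

  -- k cops can guarantee a win: cops choose starting vertices, then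
  -- the robber does, then the cops move first.
  CopsWin : ℕ → Set
  CopsWin k = Σ (CopPos k) λ c₀ → ∀ r₀ → CopWin c₀ r₀

IsCopNumber : ∀ {n} → PDigraph n → ℕ → Set
IsCopNumber G k = Game.CopsWin G k × (∀ m → Game.CopsWin G m → k ≤ m)

suc3 : Fin 3 → Fin 3
suc3 f0 = fs f0
suc3 (fs f0) = fs (fs f0)
suc3 (fs (fs f0)) = f0

pred3 : Fin 3 → Fin 3
pred3 f0 = fs (fs f0)
pred3 (fs f0) = f0
pred3 (fs (fs f0)) = fs f0

data HV (n k : ℕ) : Set where
  s   : Fin (4 * k) → HV n k
  t   : Fin 3 → Fin k → HV n k
  κ   : Fin n → Fin 3 → Fin k → HV n k
  ρ   : Fin n → Fin 3 → HV n k
  c*  : Fin k → HV n k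
  r*  : Fin 3 → HV n k

-- s m is the vertex s_x with the index x taken mod 4k
SIdx : (k : ℕ) → Fin (4 * k) → ℕ → Set
SIdx k m x = ∃[ q ] (toℕ m + q * (4 * k) ≡ x)

data Reset {n k : ℕ} : HV n k → Set where
  rs : ∀ m → Reset (s m)
  rt : ∀ i j → Reset (t i j)

module _ {n : ℕ} (G : PDigraph n) (k : ℕ) where

  -- generating unprotected edges of H (H is undirected: see HEdge)
  data UE : HV n k → HV n k → Set where
    loopκ  : ∀ v i j → UE (κ v i j) (κ v i j)
    loopρ  : ∀ v i → UE (ρ v i) (ρ v i)
    loopc* : ∀ j → UE (c* j) (c* j)
    loopr* : ∀ i → UE (r* i) (r* i)
    κκ     : ∀ v i j j' → ¬ j ≡ j' → UE (κ v i j) (κ v i j')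
    κnext  : ∀ u v i j ℓ → G u v ≡ just ℓ → UE (κ u i j) (κ v (suc3 i) j)
    ρnext  : ∀ u v i ℓ → G u v ≡ just ℓ → UE (ρ u i) (ρ v (suc3 i))
    κρnext : ∀ u v i j → G u v ≡ just unprot → UE (κ u i j) (ρ v (suc3 i))
    κs     : ∀ v i j m a → a < 4 → SIdx k m (4 * toℕ j + toℕ i + a) →
             UE (κ v i j) (s m)
    κt     : ∀ v i j → UE (κ v i j) (t i j)
    κρ     : ∀ v i j w → UE (κ v i j) (ρ w i)
    κρprev : ∀ v i j w → UE (κ v i j) (ρ w (pred3 i))
    c*s    : ∀ j m a → a < 4 → SIdx k m (4 * toℕ j + 3 + a) → UE (c* j) (s m)
    c*t    : ∀ j i → UE (c* j) (t i j)
    c*κ    : ∀ j v i j' → UE (c* j) (κ v i j')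
    c*ρ    : ∀ j v i → UE (c* j) (ρ v i)
    r*κ    : ∀ i v i' j → UE (r* i) (κ v i' j)
    r*ρ    : ∀ i v → UE (r* i) (ρ v (suc3 i))

  data PE : HV n k → HV n k → Set where
    loopR  : ∀ x → Reset x → PE x x
    clique : ∀ x y → Reset x → Reset y → ¬ x ≡ y → PE x y
    ρs     : ∀ v i m → PE (ρ v i) (s m)
    ρt     : ∀ v i j → PE (ρ v i) (t i j)
    r*r*   : ∀ i i' → ¬ i ≡ i' → PE (r* i) (r* i')
    r*s    : ∀ i m → PE (r* i) (s m)
    r*t    : ∀ i j → PE (r* i) (t i j)

  HEdge : HV n k → HV n k → Label → Set
  HEdge x y unprot = UE x y ⊎ UE y x
  HEdge x y prot   = PE x y ⊎ PE y x

  Placement : Set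
  Placement = Fin k → HV n k

  Defends : Placement → HV n k → Set
  Defends pos x = ∃[ p ] HEdge (pos p) x unprot

  IsJVertex : Fin k → HV n k → Set
  IsJVertex j x = (∃[ v ] ∃[ i ] (x ≡ κ v i j)) ⊎ (x ≡ c* j)

  InC : Fin 3 → HV n k → Set
  InC i x = ∃[ v ] ∃[ j ] (x ≡ κ v i j)

  OccupyStarters : Placement → Set
  OccupyStarters pos = ∀ j → ∃[ p ] (pos p ≡ c* j)

  AllInC : Fin 3 → Placement → Set
  AllInC i pos = ∀ p → InC i (pos p)

  ExactlyOneOnJ : Placement → Fin k → Set
  ExactlyOneOnJ pos j =
    (∃[ p ] IsJVertex j (pos p)) ×
    (∀ p p' → IsJVertex j (pos p) → IsJVertex j (pos p') → p ≡ p')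

  Stable : Placement → Set
  Stable pos = OccupyStarters pos ⊎
               (∃[ i ] (AllInC i pos × (∀ j → ExactlyOneOnJ pos j)))

module Submission where

-- A cop on κ(v;i,j) defends exactly the four consecutive core vertices s_{4j+i}, …, s_{4j+i+3},
-- a cop on c*_j the four starting at s_{4j+3}, and no other vertex is joined to S by an
-- unprotected edge; call (j, i) resp. (j, 3) the window of the cop. The defender of s_{4j+3}
-- must have its window in block j, so these k defenders are distinct and account for all
-- the cops. Looking at s_{4j+w}, where w is the offset of the window of block j - 1, shows
-- that offsets can only decrease from one block to the next; around the cycle of blocks
-- they are therefore all equal, which is exactly a stable position. The wing vertex t^i_j
-- is defended only from κ(·;i,j) or c*_j, which gives the second statement.

open import Defs
open import Data.Nat using (ℕ; zero; suc; _+_; _*_; _∸_; _≤_; _<_; _≤?_; s≤s)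
open import Data.Nat.Properties
open import Data.Nat.DivMod using (_/_; _%_; m≡m%n+[m/n]*n; m%n<n; m<n*o⇒m/o<n)
open import Data.Nat.Tactic.RingSolver using (solve-∀)
open import Data.Fin using (Fin; toℕ; fromℕ; fromℕ<; inject₁; punchOut) renaming (zero to f0; suc to fs)
open import Data.Fin.Properties
  using (toℕ-injective; toℕ<n; toℕ-fromℕ; toℕ-fromℕ<; toℕ-inject₁; any?; punchOut-injective; injective⇒≤)
  renaming (_≟_ to _≟ᶠ_)
open import Data.Fin.Induction using (<-weakInduction; >-weakInduction)
open import Data.Product using (_×_; _,_; proj₁; proj₂; ∃-syntax)
open import Data.Sum using (_⊎_; inj₁; inj₂)
open import Data.Empty using (⊥-elim)
open import Relation.Nullary using (yes; no)
open import Relation.Binary.PropositionalEquality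
open import Function.Base using (case_of_)
open import Function.Bundles using (_⇔_; mk⇔)
open import Function.Definitions using (Injective; StrictlySurjective)

carry4 : ∀ b c x y → x < 4 → y < 8 → b * 4 + x ≡ c * 4 + y →
        (c ≡ b × y ≡ x) ⊎ (suc c ≡ b × y ≡ 4 + x)
carry4 zero zero x y _ _ eq = inj₁ (refl , sym eq)
carry4 zero (suc c) x y x<4 _ eq = ⊥-elim (<⇒≱ x<4 (subst (4 ≤_) (sym eq) (m≤m+n 4 (c * 4 + y))))
carry4 (suc zero) zero x y _ _ eq = inj₂ (refl , sym eq)
carry4 (suc (suc b)) zero x y _ y<8 eq = ⊥-elim (<⇒≱ y<8 (subst (8 ≤_) eq (m≤m+n 8 (b * 4 + x))))
carry4 (suc b) (suc c) x y x<4 y<8 eq with carry4 b c x y x<4 y<8 (+-cancelˡ-≡ 4 _ _ eq)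
... | inj₁ (c≡b , y≡x) = inj₁ (cong suc c≡b , y≡x)
... | inj₂ (c≡b , y≡x) = inj₂ (cong suc c≡b , y≡x)

prev : ∀ {k} → Fin k → Fin k
prev {suc k} f0 = fromℕ k
prev {suc k} (fs j) = inject₁ j

toℕ≢+ : ∀ {k} (J : Fin k) a b → toℕ J ≢ a + (k + b)
toℕ≢+ {k} J a b eq = <⇒≱ (toℕ<n J) (subst (k ≤_) (sym eq) (≤-trans (m≤m+n k b) (m≤n+m (k + b) a)))

toℕ≡+mod⇒≡ : ∀ {k} {J j : Fin k} q → toℕ J ≡ toℕ j + q * k → J ≡ j
toℕ≡+mod⇒≡ {J = J} {j} zero eq = toℕ-injective (trans eq (+-identityʳ (toℕ j)))
toℕ≡+mod⇒≡ {J = J} {j} (suc q) eq = ⊥-elim (toℕ≢+ J (toℕ j) _ eq)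

suc-toℕ≡+mod⇒prev : ∀ {k} {J j : Fin k} q → suc (toℕ J) ≡ toℕ j + q * k → J ≡ prev j
suc-toℕ≡+mod⇒prev {suc k} {J} {f0} (suc zero) eq =
  toℕ-injective (trans (suc-injective eq) (trans (+-identityʳ k) (sym (toℕ-fromℕ k))))
suc-toℕ≡+mod⇒prev {suc k} {J} {f0} (suc (suc q)) eq = ⊥-elim (toℕ≢+ J k _ (suc-injective eq))
suc-toℕ≡+mod⇒prev {suc k} {J} {fs j} zero eq =
  toℕ-injective (trans (suc-injective eq) (trans (+-identityʳ (toℕ j)) (sym (toℕ-inject₁ j))))
suc-toℕ≡+mod⇒prev {suc k} {J} {fs j} (suc q) eq = ⊥-elim (toℕ≢+ J (toℕ j) _ (suc-injective eq))

prev-shift : ∀ {k} (j : Fin k) e → ∃[ q ] (4 * toℕ j + e + q * (4 * k) ≡ 4 * toℕ (prev j) + 4 + e)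
prev-shift {suc k} f0 e = 1 , (begin
  4 * 0 + e + 1 * (4 * suc k)  ≡⟨ wrap e k ⟩
  4 * k + 4 + e                ≡⟨ cong (λ x → 4 * x + 4 + e) (sym (toℕ-fromℕ k)) ⟩
  4 * toℕ (fromℕ k) + 4 + e    ∎)
  where
  open ≡-Reasoning
  wrap : ∀ e k → 4 * 0 + e + 1 * (4 * suc k) ≡ 4 * k + 4 + e
  wrap = solve-∀
prev-shift {suc k} (fs j) e = 0 , (begin
  4 * suc (toℕ j) + e + 0      ≡⟨ step (toℕ j) e ⟩
  4 * toℕ j + 4 + e            ≡⟨ cong (λ x → 4 * x + 4 + e) (sym (toℕ-inject₁ j)) ⟩
  4 * toℕ (inject₁ j) + 4 + e  ∎)
  where
  open ≡-Reasoning
  step : ∀ j e → 4 * suc j + e + 0 ≡ 4 * j + 4 + e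
  step = solve-∀

antitone-along-prev⇒constant : ∀ {k} (f : Fin k → ℕ) → (∀ j → f j ≤ f (prev j)) → ∀ i j → f i ≡ f j
antitone-along-prev⇒constant {suc k} f f≤f∘prev i j = trans (≡f0 i) (sym (≡f0 j))
  where
  ≤f0 : ∀ i → f i ≤ f f0
  ≤f0 = <-weakInduction (λ i → f i ≤ f f0) ≤-refl (λ i ih → ≤-trans (f≤f∘prev (fs i)) ih)
  f-last≤ : ∀ i → f (fromℕ k) ≤ f i
  f-last≤ = >-weakInduction (λ i → f (fromℕ k) ≤ f i) ≤-refl (λ i ih → ≤-trans ih (f≤f∘prev (fs i)))
  ≡f0 : ∀ i → f i ≡ f f0
  ≡f0 i = ≤-antisym (≤f0 i) (≤-trans (f≤f∘prev f0) (f-last≤ i))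

injective⇒strictlySurjective : ∀ {k} {f : Fin k → Fin k} → Injective _≡_ _≡_ f → StrictlySurjective _≡_ f
injective⇒strictlySurjective {suc k} {f} f-inj y with any? (λ x → f x ≟ᶠ y)
... | yes hit = hit
... | no miss = ⊥-elim (1+n≰n (injective⇒≤ g-inj))
  where
  y≢f : ∀ x → y ≢ f x
  y≢f x y≡fx = miss (x , sym y≡fx)
  g : Fin (suc k) → Fin k
  g x = punchOut (y≢f x)
  g-inj : Injective _≡_ _≡_ g
  g-inj {x} {x'} eq = f-inj (punchOut-injective (y≢f x) (y≢f x') eq)

core-index : ∀ {k} (j : Fin k) e → e < 4 → Fin (4 * k)
core-index {k} j e e<4 = fromℕ< (begin-strict
  4 * toℕ j + e  <⟨ +-monoʳ-< (4 * toℕ j) e<4 ⟩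
  4 * toℕ j + 4  ≡⟨ +-comm (4 * toℕ j) 4 ⟩
  4 + 4 * toℕ j  ≡⟨ sym (*-suc 4 (toℕ j)) ⟩
  4 * suc (toℕ j) ≤⟨ *-monoʳ-≤ 4 (toℕ<n j) ⟩
  4 * k          ∎)
  where open ≤-Reasoning

toℕ-core-index : ∀ {k} (j : Fin k) e (e<4 : e < 4) → toℕ (core-index j e e<4) ≡ 4 * toℕ j + e
toℕ-core-index j e e<4 = toℕ-fromℕ< _

block-decomposition : ∀ {k} (m : Fin (4 * k)) → ∃[ j ] ∃[ e ] (e < 4 × toℕ m ≡ 4 * toℕ j + e)
block-decomposition {k} m = fromℕ< block<k , toℕ m % 4 , m%n<n (toℕ m) 4 , (begin
  toℕ m                               ≡⟨ m≡m%n+[m/n]*n (toℕ m) 4 ⟩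
  toℕ m % 4 + toℕ m / 4 * 4           ≡⟨ +-comm (toℕ m % 4) _ ⟩
  toℕ m / 4 * 4 + toℕ m % 4           ≡⟨ cong (_+ toℕ m % 4) (*-comm (toℕ m / 4) 4) ⟩
  4 * (toℕ m / 4) + toℕ m % 4         ≡⟨ cong (λ b → 4 * b + toℕ m % 4) (sym (toℕ-fromℕ< block<k)) ⟩
  4 * toℕ (fromℕ< block<k) + toℕ m % 4 ∎)
  where
  open ≡-Reasoning
  block<k : toℕ m / 4 < k
  block<k = m<n*o⇒m/o<n (subst (toℕ m <_) (*-comm 4 k) (toℕ<n m))

Covers : ∀ {k} → Fin k → ℕ → Fin (4 * k) → Set
Covers {k} J w m = ∃[ a ] (a < 4 × SIdx k m (4 * toℕ J + w + a))

covers⇒block-equation : ∀ {k} {J j : Fin k} {m : Fin (4 * k)} {w e} →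
                        toℕ m ≡ 4 * toℕ j + e → Covers J w m →
                        ∃[ q ] ∃[ a ] (a < 4 × (toℕ j + q * k) * 4 + e ≡ toℕ J * 4 + (w + a))
covers⇒block-equation {k} {J} {j} {m} {w} {e} m≡ (a , a<4 , q , eq) = q , a , a<4 , (begin
  (toℕ j + q * k) * 4 + e       ≡⟨ sym (lhs (toℕ j) e q k) ⟩
  4 * toℕ j + e + q * (4 * k)   ≡⟨ cong (_+ q * (4 * k)) (sym m≡) ⟩
  toℕ m + q * (4 * k)           ≡⟨ eq ⟩
  4 * toℕ J + w + a             ≡⟨ rhs (toℕ J) w a ⟩
  toℕ J * 4 + (w + a)           ∎)
  where
  open ≡-Reasoning
  lhs : ∀ j e q k → 4 * j + e + q * (4 * k) ≡ (j + q * k) * 4 + e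
  lhs = solve-∀
  rhs : ∀ J w a → 4 * J + w + a ≡ J * 4 + (w + a)
  rhs = solve-∀

covers⇒same-or-prev-block : ∀ {k} {J j : Fin k} {m : Fin (4 * k)} {w e} → w ≤ 3 → e < 4 →
             toℕ m ≡ 4 * toℕ j + e → Covers J w m →
             (J ≡ j × w ≤ e) ⊎ (J ≡ prev j × e < w)
covers⇒same-or-prev-block {k} {J} {j} {w = w} {e} w≤3 e<4 m≡ cov with covers⇒block-equation {J = J} {j} m≡ cov
... | q , a , a<4 , blocks
  with carry4 (toℕ j + q * k) (toℕ J) e (w + a) e<4 (s≤s (+-mono-≤ w≤3 (<⇒≤ a<4))) blocks
... | inj₁ (J≡ , w+a≡e) = inj₁ (toℕ≡+mod⇒≡ q J≡ , subst (w ≤_) w+a≡e (m≤m+n w a))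
... | inj₂ (J+1≡ , w+a≡4+e) = inj₂ (suc-toℕ≡+mod⇒prev q J+1≡ , e<w)
  where
  open ≤-Reasoning
  e<w : e < w
  e<w = +-cancelˡ-< 4 e w (begin-strict
    4 + e  ≡⟨ sym w+a≡4+e ⟩
    w + a  <⟨ +-monoʳ-< w a<4 ⟩
    w + 4  ≡⟨ +-comm w 4 ⟩
    4 + w  ∎)

covered-by-some-block : ∀ {k} (m : Fin (4 * k)) {w} → w ≤ 3 → ∃[ J ] Covers J w m
covered-by-some-block {k} m {w} w≤3 with block-decomposition {k} m
... | j , e , e<4 , m≡ with w ≤? e
...   | yes w≤e = j , e ∸ w , ≤-<-trans (m∸n≤m e w) e<4 , 0 , (begin
  toℕ m + 0              ≡⟨ +-identityʳ (toℕ m) ⟩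
  toℕ m                  ≡⟨ m≡ ⟩
  4 * toℕ j + e          ≡⟨ cong (4 * toℕ j +_) (sym (m+[n∸m]≡n w≤e)) ⟩
  4 * toℕ j + (w + (e ∸ w)) ≡⟨ sym (+-assoc (4 * toℕ j) w (e ∸ w)) ⟩
  4 * toℕ j + w + (e ∸ w) ∎)
  where open ≡-Reasoning
...   | no w≰e = prev j , (4 + e) ∸ w , a<4 , q , (begin
  toℕ m + q * (4 * k)         ≡⟨ cong (_+ q * (4 * k)) m≡ ⟩
  4 * toℕ j + e + q * (4 * k) ≡⟨ shift ⟩
  4 * toℕ (prev j) + 4 + e    ≡⟨ +-assoc (4 * toℕ (prev j)) 4 e ⟩
  4 * toℕ (prev j) + (4 + e)  ≡⟨ cong (4 * toℕ (prev j) +_) (sym (m+[n∸m]≡n w≤4+e)) ⟩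
  4 * toℕ (prev j) + (w + ((4 + e) ∸ w)) ≡⟨ sym (+-assoc (4 * toℕ (prev j)) w _) ⟩
  4 * toℕ (prev j) + w + ((4 + e) ∸ w)   ∎)
  where
  open ≡-Reasoning
  q : ℕ
  q = proj₁ (prev-shift j e)
  shift : 4 * toℕ j + e + q * (4 * k) ≡ 4 * toℕ (prev j) + 4 + e
  shift = proj₂ (prev-shift j e)
  w≤4+e : w ≤ 4 + e
  w≤4+e = ≤-trans w≤3 (≤-trans (n≤1+n 3) (m≤m+n 4 e))
  a<4 : (4 + e) ∸ w < 4
  a<4 = subst ((4 + e) ∸ w <_) (m+n∸n≡m 4 e) (∸-monoʳ-< (≰⇒> w≰e) w≤4+e)

data Window {n k : ℕ} : HV n k → Fin k → ℕ → Set where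
  κ-window  : ∀ v i j → Window (κ v i j) j (toℕ i)
  c*-window : ∀ j → Window (c* j) j 3

module _ {n k : ℕ} where

  window≤3 : ∀ {x : HV n k} {J w} → Window x J w → w ≤ 3
  window≤3 (κ-window v i j) = <⇒≤ (toℕ<n i)
  window≤3 (c*-window j)    = ≤-refl

  window-unique : ∀ {x : HV n k} {J J' w w'} → Window x J w → Window x J' w' → J ≡ J' × w ≡ w'
  window-unique (κ-window _ _ _) (κ-window _ _ _) = refl , refl
  window-unique (c*-window _)    (c*-window _)    = refl , refl

  window⇒starter : ∀ {x : HV n k} {j w} → Window x j w → w ≡ 3 → x ≡ c* j
  window⇒starter (κ-window v i j) i≡3 = ⊥-elim (<⇒≢ (toℕ<n i) i≡3)
  window⇒starter (c*-window j)    _   = refl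

module _ {n : ℕ} (G : PDigraph n) {k : ℕ} where

  window⇒InC : ∀ {x : HV n k} {J w} {i} → Window x J w → w ≡ toℕ i → InC G k i x
  window⇒InC (κ-window v _ j) i'≡i = v , j , cong (λ i → κ v i j) (toℕ-injective i'≡i)
  window⇒InC {i = i} (c*-window j) 3≡i = ⊥-elim (<⇒≢ (toℕ<n i) (sym 3≡i))

  window⇒jVertex : ∀ {x : HV n k} {j w} → Window x j w → IsJVertex G k j x
  window⇒jVertex (κ-window v i j) = inj₁ (v , i , refl)
  window⇒jVertex (c*-window j)    = inj₂ refl

  jVertex-window-block : ∀ {x : HV n k} {j J w} → IsJVertex G k j x → Window x J w → j ≡ J
  jVertex-window-block (inj₁ (_ , _ , refl)) (κ-window _ _ _) = refl
  jVertex-window-block (inj₂ refl)           (c*-window _)    = refl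

  jVertex-in-C : ∀ {x : HV n k} {i j} → IsJVertex G k j x → InC G k i x → ∃[ v ] x ≡ κ v i j
  jVertex-in-C (inj₁ (v , _ , refl)) (_ , _ , refl) = v , refl
  jVertex-in-C (inj₂ refl)           (_ , _ , ())

  core-edge⇒window : ∀ {x : HV n k} {m} → HEdge G k x (s m) unprot →
                     ∃[ J ] ∃[ w ] (Window x J w × Covers J w m)
  core-edge⇒window (inj₁ (κs v i j _ a a<4 idx)) = j , toℕ i , κ-window v i j , a , a<4 , idx
  core-edge⇒window (inj₁ (c*s j _ a a<4 idx))    = j , 3 , c*-window j , a , a<4 , idx
  core-edge⇒window (inj₂ ())

  window⇒core-edge : ∀ {x : HV n k} {J w m} → Window x J w → Covers J w m → HEdge G k x (s m) unprot
  window⇒core-edge (κ-window v i j) (a , a<4 , idx) = inj₁ (κs v i j _ a a<4 idx)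
  window⇒core-edge (c*-window j)    (a , a<4 , idx) = inj₁ (c*s j _ a a<4 idx)

  wing-edge-in-C⇒same-index : ∀ {x : HV n k} {i i' j} → HEdge G k x (t i j) unprot → InC G k i' x → i' ≡ i
  wing-edge-in-C⇒same-index (inj₁ (κt _ _ _)) (_ , _ , refl) = refl
  wing-edge-in-C⇒same-index (inj₁ (c*t _ _))  (_ , _ , ())
  wing-edge-in-C⇒same-index (inj₂ ())

stable⇒core-defended : ∀ {n} (G : PDigraph n) k (pos : Placement G k) →
                       Stable G k pos → ∀ m → Defends G k pos (s m)
stable⇒core-defended G k pos (inj₁ starters) m with covered-by-some-block {k} m ≤-refl
... | J , cov with starters J
... | p , pos-p≡c* = p , window⇒core-edge G (subst (λ x → Window x J 3) (sym pos-p≡c*) (c*-window J)) cov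
stable⇒core-defended G k pos (inj₂ (i , inC , one)) m with covered-by-some-block {k} m (<⇒≤ (toℕ<n i))
... | J , cov with proj₁ (one J)
... | p , jv with jVertex-in-C G jv (inC p)
... | v , pos-p≡κ = p , window⇒core-edge G (subst (λ x → Window x J (toℕ i)) (sym pos-p≡κ) (κ-window v i J)) cov

defender-of-offset : ∀ {n} (G : PDigraph n) {k} (pos : Placement G k) {m : Fin (4 * k)} {j : Fin k} {e} →
                  e < 4 → toℕ m ≡ 4 * toℕ j + e → Defends G k pos (s m) →
                  ∃[ p ] ∃[ J ] ∃[ w ] (Window (pos p) J w × ((J ≡ j × w ≤ e) ⊎ (J ≡ prev j × e < w)))
defender-of-offset G pos {j = j} e<4 m≡ (p , edge) with core-edge⇒window G edge
... | J , w , win , cov = p , J , w , win , covers⇒same-or-prev-block {J = J} {j} (window≤3 win) e<4 m≡ cov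

module CoreDefended {n} (G : PDigraph n) {k} (pos : Placement G k)
                    (defended : ∀ m → Defends G k pos (s m)) where

  defender-at : ∀ j e (e<4 : e < 4) →
                ∃[ p ] ∃[ J ] ∃[ w ] (Window (pos p) J w × ((J ≡ j × w ≤ e) ⊎ (J ≡ prev j × e < w)))
  defender-at j e e<4 = defender-of-offset G pos e<4 (toℕ-core-index j e e<4) (defended (core-index j e e<4))

  opaque
    corner-defender : ∀ j → ∃[ p ] ∃[ w ] Window (pos p) j w
    corner-defender j = case defender-at j 3 (n<1+n 3) of λ where
      (p , _ , w , win , inj₁ (refl , _)) → p , w , win
      (_ , _ , _ , win , inj₂ (_ , 3<w))  → ⊥-elim (<⇒≱ 3<w (window≤3 win))

  defender : Fin k → Fin k
  defender j = proj₁ (corner-defender j)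

  W : Fin k → ℕ
  W j = proj₁ (proj₂ (corner-defender j))

  defender-window : ∀ j → Window (pos (defender j)) j (W j)
  defender-window j = proj₂ (proj₂ (corner-defender j))

  W<4 : ∀ j → W j < 4
  W<4 j = s≤s (window≤3 (defender-window j))

  defender-injective : Injective _≡_ _≡_ defender
  defender-injective {a} {b} eq =
    proj₁ (window-unique (defender-window a) (subst (λ p → Window (pos p) b (W b)) (sym eq) (defender-window b)))

  defender-surjective : StrictlySurjective _≡_ defender
  defender-surjective = injective⇒strictlySurjective defender-injective

  cop-window : ∀ p → ∃[ J ] Window (pos p) J (W J)
  cop-window p =
    let J , defender-J≡p = defender-surjective p
    in J , subst (λ q → Window (pos q) J (W J)) defender-J≡p (defender-window J)

  window-width : ∀ {p J w} → Window (pos p) J w → w ≡ W J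
  window-width {p} win =
    let J' , win' = cop-window p
        J≡J' , w≡ = window-unique win win'
    in trans w≡ (cong W (sym J≡J'))

  W-antitone : ∀ j → W j ≤ W (prev j)
  W-antitone j = case defender-at j (W (prev j)) (W<4 (prev j)) of λ where
    (_ , _ , _ , win , inj₁ (refl , w≤))  → subst (_≤ W (prev j)) (window-width win) w≤
    (_ , _ , _ , win , inj₂ (refl , e<w)) → ⊥-elim (<-irrefl (sym (window-width win)) e<w)

  W-constant : ∀ i j → W i ≡ W j
  W-constant = antitone-along-prev⇒constant W W-antitone

  jVertex⇒defender : ∀ {j p} → IsJVertex G k j (pos p) → p ≡ defender j
  jVertex⇒defender {j} {p} jv =
    let J , defender-J≡p = defender-surjective p
        win = subst (λ q → Window (pos q) J (W J)) defender-J≡p (defender-window J)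
    in trans (sym defender-J≡p) (cong defender (sym (jVertex-window-block G jv win)))

  stable : Fin k → Stable G k pos
  stable j₀ with m≤n⇒m<n∨m≡n (window≤3 (defender-window j₀))
  ... | inj₂ W≡3 = inj₁ λ j → defender j , window⇒starter (defender-window j) (trans (W-constant j j₀) W≡3)
  ... | inj₁ W<3 = inj₂ (i , inC , one)
    where
    i : Fin 3
    i = fromℕ< W<3
    inC : AllInC G k i pos
    inC p = let J , win = cop-window p in
      window⇒InC G win (trans (W-constant J j₀) (sym (toℕ-fromℕ< W<3)))
    one : ∀ j → ExactlyOneOnJ G k pos j
    one j = (defender j , window⇒jVertex G (defender-window j)) ,
            λ p p' jv jv' → trans (jVertex⇒defender jv) (sym (jVertex⇒defender jv'))

core-defended⇒stable : ∀ {n} (G : PDigraph n) k (pos : Placement G k) →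
                       (∀ m → Defends G k pos (s m)) → Stable G k pos
core-defended⇒stable G zero    pos _        = inj₁ λ ()
core-defended⇒stable G (suc k) pos defended = CoreDefended.stable G pos defended f0

stable⇒wing-defended⇔ : ∀ {n} (G : PDigraph n) k (pos : Placement G k) → Stable G k pos → ∀ i →
  (∀ j → Defends G k pos (t i j)) ⇔ (AllInC G k i pos ⊎ OccupyStarters G k pos)
stable⇒wing-defended⇔ G k pos stable i = mk⇔ (to stable) (from stable)
  where
  starters⇒defended : OccupyStarters G k pos → ∀ j → Defends G k pos (t i j)
  starters⇒defended starters j =
    let p , pos-p≡c* = starters j in p , inj₁ (subst (λ x → UE G k x (t i j)) (sym pos-p≡c*) (c*t j i))

  to : Stable G k pos → (∀ j → Defends G k pos (t i j)) → AllInC G k i pos ⊎ OccupyStarters G k pos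
  to (inj₁ starters)         _        = inj₂ starters
  to (inj₂ (_ , inC , _))  defended = inj₁ λ p →
    let _ , j , _ = inC p
        q , edge = defended j
    in subst (λ i → InC G k i (pos p)) (wing-edge-in-C⇒same-index G edge (inC q)) (inC p)

  from : Stable G k pos → AllInC G k i pos ⊎ OccupyStarters G k pos → ∀ j → Defends G k pos (t i j)
  from _                     (inj₂ starters) = starters⇒defended starters
  from (inj₁ starters)       (inj₁ _)        = starters⇒defended starters
  from (inj₂ (_ , _ , one)) (inj₁ inC) j    =
    let p , jv = proj₁ (one j)
        v , pos-p≡κ = jVertex-in-C G jv (inC p)
    in p , inj₁ (subst (λ x → UE G k x (t i j)) (sym pos-p≡κ) (κt v i j))

lemma4p1 : ∀ {n} (G : PDigraph n) (k : ℕ) → IsCopNumber G k →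
    (pos : Placement G k) →
    (((∀ m → Defends G k pos (s m)) ⇔ Stable G k pos) ×
     (Stable G k pos → ∀ i →
       ((∀ j → Defends G k pos (t i j)) ⇔ (AllInC G k i pos ⊎ OccupyStarters G k pos))))
-- Only the shape of H matters here, not that k is the cop number of G.
lemma4p1 G k _ pos =
  mk⇔ (core-defended⇒stable G k pos) (stable⇒core-defended G k pos) ,
  stable⇒wing-defended⇔ G k pos
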